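{- Let $G$ be a planar graph subject to edge deletions, let $\mathcal{P}$ be an $r$-division of $G$ (updated under deletions as described in the context), and let $V_s$ be a skeleton set with $\partial\mathcal{P} \subseteq V_s \subseteq V$. Let $G_s$ be the skeleton graph for $\mathcal{P}$ and $V_s$, maintained so that after each deletion it is the skeleton graph of the current graph and current division. Then an edge deletion in $G$ causes an increase in the number of connected components of $G_s$ if and only if the deletion is critical in $G$ (the deleted edge was a bridge of $G$) and there exists a region $R$ of $\mathcal{P}$ in which the deletion disconnects some two vertices of $V_s$ (i.e., two vertices of $V_s \cap V(R)$ joined by a path in $R$ before the deletion are not joined by a path in $R$ after it).
   Context: A region of a graph $G$ is an edge-induced subgraph. A boundary vertex of a region $R$ is a vertex of $R$ incident to an edge not in $R$; $\partial R$ denotes the set of boundary vertices of $R$. An $r$-division $\mathcal{P}$ of an $n$-vertex planar graph $G$ is a partition of the edges of $G$ into $O(n/r)$ edge-disjoint regions (which may share vertices), each with at most $r$ vertices and $O(\sqrt r)$ boundary vertices; $\partial\mathcal{P}$ is the union of all $\partial R$. When edges are deleted from $G$, the $r$-division is updated by deleting the same edges from the regions containing them; the resulting graphs (which may contain isolated vertices) are still called the regions, and the set of boundary vertices is kept equal to the original $\partial\mathcal{P}$. Skeleton graph: given such $\mathcal{P}$ and a skeleton set $V_s$ with $\partial\mathcal{P}\subseteq V_s\subseteq V$, the skeleton graph has vertex set $V_s$ plus auxiliary vertices, constructed as follows: for each region $R$, partition $V_s\cap V(R)$ into classes $V_1,\dots,V_k$ where two vertices are in the same class iff they are joined by a path in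 $R$; for each class $V_i$ add a new auxiliary vertex $w_i$ and edges $w_i x$ for all $x\in V_i$. A deletion is critical in $G$ if it increases the number of connected components of $G$. -}

module Defs where

open import Data.Nat using (ℕ)
open import Data.Fin as F using (Fin)
open import Data.Fin.Subset using (Subset; _∈_)
open import Data.Product using (Σ; _×_; _,_; proj₁; proj₂)
open import Data.Sum using (_⊎_; inj₁; inj₂)
open import Data.Empty using (⊥)
open import Relation.Nullary using (¬_)
open import Relation.Binary.PropositionalEquality using (_≡_)
open import Relation.Binary.Construct.Closure.Symmetric using (SymClosure)
open import Relation.Binary.Construct.Closure.ReflexiveTransitive using (Star)
open import Function.Bundles using (_⇔_)

Conn : {V : Set} → (V → V → Set) → V → V → Set
Conn Adj = Star (SymClosure Adj)

-- The graph has exactly c connected components: there is a surjection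
-- onto Fin c identifying exactly the connected pairs of vertices
-- (i.e. a bijection between the set of components and Fin c).
HasComponents : {V : Set} → (V → V → Set) → ℕ → Set
HasComponents {V} Adj c =
  Σ (V → Fin c) λ f →
    (∀ (i : Fin c) → Σ V λ v → f v ≡ i) ×
    (∀ u v → Conn Adj u v ⇔ (f u ≡ f v))

-- The (original) graph G: vertices Fin n, edges Fin m (multigraph allowed),
-- ends e = the two endpoints of edge e.  The r-division is given by
-- reg : Fin m → Fin k, assigning each edge its region (a partition of the
-- edges into k regions).  The current graph after some deletions is
-- given by a predicate on edges saying which edges are still present.

module _ {n m k : ℕ} (ends : Fin m → Fin n × Fin n) (reg : Fin m → Fin k) where

  Inc : Fin m → Fin n → Set
  Inc e v = (proj₁ (ends e) ≡ v) ⊎ (proj₂ (ends e) ≡ v)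

  GAdj : (Fin m → Set) → Fin n → Fin n → Set
  GAdj present u v = Σ (Fin m) λ e → present e × (ends e ≡ (u , v))

  RAdj : (Fin m → Set) → Fin k → Fin n → Fin n → Set
  RAdj present R = GAdj (λ e → present e × (reg e ≡ R))

  -- Regions are edge-induced in the
  -- original graph; after deletions they keep their vertices (possibly
  -- isolated), so V(R) is computed from the original edges.
  InV : Fin k → Fin n → Set
  InV R v = Σ (Fin m) λ e → (reg e ≡ R) × Inc e v

  Boundary : Fin n → Set
  Boundary v = Σ (Fin k) λ R → InV R v × (Σ (Fin m) λ e → Inc e v × ¬ (reg e ≡ R))

  module _ (Vs : Subset n) (present : Fin m → Set) where

    -- x is the canonical (least) representative of its class in the
    -- partition of Vs ∩ V(R) by connectivity in (the current) R
    IsRep : Fin k → Fin n → Set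
    IsRep R x = (x ∈ Vs) × InV R x ×
      (∀ y → y ∈ Vs → InV R y → Conn (RAdj present R) x y → x F.≤ y)

    -- vertices of the skeleton graph: the skeleton vertices, plus one
    -- auxiliary vertex w per (region, class), indexed by the class's
    -- least element
    SkV : Set
    SkV = (Σ (Fin n) λ x → x ∈ Vs) ⊎ (Σ (Fin k × Fin n) λ p → IsRep (proj₁ p) (proj₂ p))

    -- edges of the skeleton graph: w_i x for all x in the class V_i
    SkAdj : SkV → SkV → Set
    SkAdj (inj₂ ((R , x) , _)) (inj₁ (y , _)) = InV R y × Conn (RAdj present R) x y
    SkAdj _ _ = ⊥

Del : {m : ℕ} → Subset m → Fin m → Fin m → Set
Del A e f = (f ∈ A) × ¬ (f ≡ e)

module Submission where

-- 1. Counting: if ψ maps one graph to another, reflects connectivity and meets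
--    every component, the target has more components iff ψ pulls apart a
--    connected pair.  Applied to G ⟶ G - e and to G_s ⟶ G_s - e (auxiliary
--    vertices go to their representatives), both counts become "some pair splits".
-- 2. A path of G between vertices of V_s leaves a region only at boundary
--    vertices, which lie in V_s; so it is a chain of hops inside regions, and
--    each hop is a two-edge path of G_s.  Hence G_s splits iff G splits on V_s.
-- 3. If deleting u—v disconnects some pair, it disconnects u from v.  So a
--    V_s-pair split in G has a broken hop in some region, and if e is a bridge,
--    a V_s-pair that some region loses through e is lost in G as well.
-- Decidable connectivity and least class elements build the auxiliary vertices.

open import Defs
open import Data.Nat using (ℕ; _<_; suc; s≤s; z≤n)
open import Data.Fin as F using (Fin; zero; suc; _≟_; punchOut)
open import Data.Fin.Properties using (any?; pigeonhole; injective⇒≤; punchOut-injective; <⇒≢)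
open import Data.Fin.Subset using (Subset; _∈_)
open import Data.Fin.Subset.Properties using (_∈?_)
open import Data.Vec.Properties.WithK using ([]=-irrelevant)
open import Data.Product using (Σ; _×_; _,_; proj₁; proj₂)
open import Data.Sum using (_⊎_; inj₁; inj₂)
import Data.Sum as Sum
open import Data.Empty using (⊥-elim)
open import Data.List using (List; []; _∷_; allFin)
open import Data.List.Relation.Unary.Any using (here; there)
import Data.List.Membership.Propositional as List
open import Data.List.Membership.Propositional.Properties using (∈-allFin)
open import Function.Base using (id)
open import Function.Bundles using (_⇔_; mk⇔; Equivalence)
open import Function.Definitions using (Injective)
open import Relation.Nullary using (¬_; Dec; yes; no)
open import Relation.Nullary.Decidable using (_×-dec_; _⊎-dec_; map′; ¬?)
open import Relation.Unary using (Decidable)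
open import Relation.Binary.PropositionalEquality using (_≡_; _≢_; refl; sym; trans; cong; subst)
open import Relation.Binary.Construct.Closure.Symmetric using (SymClosure; fwd; bwd)
open import Relation.Binary.Construct.Closure.ReflexiveTransitive using (Star; ε; _◅_; _◅◅_)
open import Relation.Binary.Construct.Closure.Equivalence
  using (symmetric; isEquivalence; map; gfold; return)

Separated : {V : Set} → (V → V → Set) → (V → V → Set) → V → V → Set
Separated Before After x y = Conn Before x y × ¬ Conn After x y

-- Paths in a graph Adj⁺ whose only edges beyond those of Adj join u to v.
-- Such a path either stays in Adj or crosses the edge u—v; this describes
-- exactly what the extra edge adds to connectivity.
module ExtraEdge {V : Set} {Adj Adj⁺ : V → V → Set} (u v : V)
  (split : ∀ {p q} → Adj⁺ p q → Adj p q ⊎ ((p ≡ u) × (q ≡ v))) where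

  ViaEdge : V → V → Set
  ViaEdge x y = (Conn Adj x u × Conn Adj v y) ⊎ (Conn Adj x v × Conn Adj u y)

  prepend : ∀ {x w y} → Conn Adj x w → Conn Adj w y ⊎ ViaEdge w y → Conn Adj x y ⊎ ViaEdge x y
  prepend p (inj₁ q) = inj₁ (p ◅◅ q)
  prepend p (inj₂ (inj₁ (q , r))) = inj₂ (inj₁ (p ◅◅ q , r))
  prepend p (inj₂ (inj₂ (q , r))) = inj₂ (inj₂ (p ◅◅ q , r))

  conn⁺⇒conn-or-via : ∀ {x y} → Conn Adj⁺ x y → Conn Adj x y ⊎ ViaEdge x y
  conn⁺⇒conn-or-via ε = inj₁ ε
  conn⁺⇒conn-or-via (fwd a ◅ p) with split a | conn⁺⇒conn-or-via p
  ... | inj₁ b             | rest                  = prepend (return b) rest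
  ... | inj₂ (refl , refl) | inj₁ vy                = inj₂ (inj₁ (ε , vy))
  ... | inj₂ (refl , refl) | inj₂ (inj₁ (_ , vy))   = inj₂ (inj₁ (ε , vy))
  ... | inj₂ (refl , refl) | inj₂ (inj₂ (_ , uy))   = inj₁ uy
  conn⁺⇒conn-or-via (bwd a ◅ p) with split a | conn⁺⇒conn-or-via p
  ... | inj₁ b             | rest                  = prepend (symmetric _ (return b)) rest
  ... | inj₂ (refl , refl) | inj₁ uy                = inj₂ (inj₂ (ε , uy))
  ... | inj₂ (refl , refl) | inj₂ (inj₁ (_ , vy))   = inj₁ vy
  ... | inj₂ (refl , refl) | inj₂ (inj₂ (_ , uy))   = inj₂ (inj₂ (ε , uy))

  conn-or-via⇒conn⁺ : (∀ {p q} → Adj p q → Adj⁺ p q) → Adj⁺ u v →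
    ∀ {x y} → Conn Adj x y ⊎ ViaEdge x y → Conn Adj⁺ x y
  conn-or-via⇒conn⁺ sub uv (inj₁ p) = map sub p
  conn-or-via⇒conn⁺ sub uv (inj₂ (inj₁ (p , q))) = map sub p ◅◅ return uv ◅◅ map sub q
  conn-or-via⇒conn⁺ sub uv (inj₂ (inj₂ (p , q))) =
    map sub p ◅◅ symmetric _ (return uv) ◅◅ map sub q

  separated⇒via : ∀ {x y} → Separated Adj⁺ Adj x y → ViaEdge x y
  separated⇒via (p , ¬q) with conn⁺⇒conn-or-via p
  ... | inj₁ q = ⊥-elim (¬q q)
  ... | inj₂ r = r

  separated⇒ends-separated : ∀ {x y} → Separated Adj⁺ Adj x y → ¬ Conn Adj u v
  separated⇒ends-separated s uv with separated⇒via s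
  ... | inj₁ (xu , vy) = proj₂ s (xu ◅◅ uv ◅◅ vy)
  ... | inj₂ (xv , uy) = proj₂ s (xv ◅◅ symmetric _ uv ◅◅ uy)

least : ∀ {n} (P : Fin n → Set) → Decidable P → ∀ z → P z →
        Σ (Fin n) λ r → P r × (∀ y → P y → r F.≤ y)
least {suc n} P P? z pz with P? zero
... | yes p0 = zero , p0 , λ _ _ → z≤n
least {suc n} P P? zero    pz | no ¬p0 = ⊥-elim (¬p0 pz)
least {suc n} P P? (suc z) pz | no ¬p0 with least (λ x → P (suc x)) (λ x → P? (suc x)) z pz
... | r , pr , r-least = suc r , pr , λ { zero p → ⊥-elim (¬p0 p) ; (suc y) p → s≤s (r-least y p) }

injective-missing⇒< : ∀ {a b} (g : Fin a → Fin b) → Injective _≡_ _≡_ g →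
  (p : Fin b) → (∀ i → g i ≢ p) → a < b
injective-missing⇒< {b = suc b} g g-inj p missed = s≤s (injective⇒≤ {f = squeeze} squeeze-inj)
  where
    p≢g : ∀ i → p ≢ g i
    p≢g i p≡gi = missed i (sym p≡gi)
    squeeze : Fin _ → Fin b
    squeeze i = punchOut (p≢g i)
    squeeze-inj : Injective _≡_ _≡_ squeeze
    squeeze-inj {i} {j} eq = g-inj (punchOut-injective (p≢g i) (p≢g j) eq)

module Labelling {V : Set} {Adj : V → V → Set} {c : ℕ} (H : HasComponents Adj c) where
  comp : V → Fin c
  comp = proj₁ H

  rep : Fin c → V
  rep i = proj₁ (proj₁ (proj₂ H) i)

  comp-rep : ∀ i → comp (rep i) ≡ i
  comp-rep i = proj₂ (proj₁ (proj₂ H) i)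

  same : ∀ {a b} → Conn Adj a b → comp a ≡ comp b
  same = Equivalence.to (proj₂ (proj₂ H) _ _)

  joined : ∀ {a b} → comp a ≡ comp b → Conn Adj a b
  joined = Equivalence.from (proj₂ (proj₂ H) _ _)

-- Components map injectively i ↦ [ψ(rep i)].
module ComponentCount {V V' : Set} {Adj : V → V → Set} {Adj' : V' → V' → Set} {c c' : ℕ}
  (H : HasComponents Adj c) (H' : HasComponents Adj' c') (ψ : V → V')
  (covers : ∀ b → Σ V λ a → Conn Adj' (ψ a) b)
  (reflects : ∀ {a b} → Conn Adj' (ψ a) (ψ b) → Conn Adj a b) where

  open Labelling H
  open Labelling H' renaming (comp to comp'; rep to rep'; comp-rep to comp-rep'; same to same'; joined to joined')

  induced : Fin c → Fin c'
  induced i = comp' (ψ (rep i))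

  induced-hit : ∀ j x → induced j ≡ comp' (ψ x) → j ≡ comp x
  induced-hit j x eq = trans (sym (comp-rep j)) (same (reflects (joined' eq)))

  induced-injective : Injective _≡_ _≡_ induced
  induced-injective {i} {j} eq = trans (induced-hit i (rep j) eq) (comp-rep j)

  more⇔separated : c < c' ⇔ (Σ V λ a → Σ V λ b → Conn Adj a b × ¬ Conn Adj' (ψ a) (ψ b))
  more⇔separated = mk⇔ more⇒separated separated⇒more
    where
      preimage : Fin c' → V
      preimage j = proj₁ (covers (rep' j))

      -- two components of the target have preimages in one component
      more⇒separated : c < c' → Σ V λ a → Σ V λ b → Conn Adj a b × ¬ Conn Adj' (ψ a) (ψ b)
      more⇒separated lt with pigeonhole lt (λ j → comp (preimage j))
      ... | i , j , i<j , eq = preimage i , preimage j , joined eq , λ q → <⇒≢ i<j (from-one-component q)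
        where
          from-one-component : Conn Adj' (ψ (preimage i)) (ψ (preimage j)) → i ≡ j
          from-one-component q = trans (sym (comp-rep' i)) (trans
            (same' (symmetric _ (proj₂ (covers (rep' i))) ◅◅ q ◅◅ proj₂ (covers (rep' j))))
            (comp-rep' j))

      -- [ψ a] and [ψ b] are distinct, so one of them is not hit by induced
      separated⇒more : (Σ V λ a → Σ V λ b → Conn Adj a b × ¬ Conn Adj' (ψ a) (ψ b)) → c < c'
      separated⇒more (a , b , ab , ¬ψab) with induced (comp a) ≟ comp' (ψ a)
      ... | no ne = injective-missing⇒< induced induced-injective (comp' (ψ a))
              λ j eq → ne (subst (λ t → induced t ≡ comp' (ψ a)) (induced-hit j a eq) eq)
      ... | yes eq-a = injective-missing⇒< induced induced-injective (comp' (ψ b))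
              λ j eq → ¬ψab (joined' (trans (sym eq-a)
                (subst (λ t → induced t ≡ comp' (ψ b))
                  (trans (induced-hit j b eq) (sym (same ab))) eq)))

module EdgeSets {n m k : ℕ} (ends : Fin m → Fin n × Fin n) (reg : Fin m → Fin k) where

  GAdj-mono : {Q Q' : Fin m → Set} → (∀ {f} → Q f → Q' f) →
    ∀ {p q} → GAdj ends reg Q p q → GAdj ends reg Q' p q
  GAdj-mono sub (f , qf , eq) = f , sub qf , eq

  GAdj-extra : {Q Q' : Fin m → Set} (e : Fin m) → (∀ {f} → Q f → Q' f ⊎ f ≡ e) →
    ∀ {p q} → GAdj ends reg Q p q →
    GAdj ends reg Q' p q ⊎ ((p ≡ proj₁ (ends e)) × (q ≡ proj₂ (ends e)))
  GAdj-extra e sub (f , qf , eq) with sub qf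
  ... | inj₁ q'f = inj₁ (f , q'f , eq)
  ... | inj₂ refl = inj₂ (sym (cong proj₁ eq) , sym (cong proj₂ eq))

  Listed : (Fin m → Set) → List (Fin m) → Fin m → Set
  Listed Q L f = Q f × f List.∈ L

  no-edges : ∀ {Q x y} → Conn (GAdj ends reg (Listed Q [])) x y → x ≡ y
  no-edges ε = refl
  no-edges (fwd (_ , (_ , ()) , _) ◅ _)
  no-edges (bwd (_ , (_ , ()) , _) ◅ _)

  listed-conn? : ∀ Q → Decidable Q → ∀ L x y → Dec (Conn (GAdj ends reg (Listed Q L)) x y)
  listed-conn? Q Q? [] x y with x ≟ y
  ... | yes refl = yes ε
  ... | no x≢y = no (λ p → x≢y (no-edges p))
  listed-conn? Q Q? (f₀ ∷ L) x y with Q? f₀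
  ... | no ¬q₀ = map′ (map (GAdj-mono extend)) (map (GAdj-mono shrink)) (listed-conn? Q Q? L x y)
    where
      extend : ∀ {f} → Listed Q L f → Listed Q (f₀ ∷ L) f
      extend (qf , f∈L) = qf , there f∈L
      shrink : ∀ {f} → Listed Q (f₀ ∷ L) f → Listed Q L f
      shrink (qf , here refl) = ⊥-elim (¬q₀ qf)
      shrink (qf , there f∈L) = qf , f∈L
  ... | yes q₀ = map′ (conn-or-via⇒conn⁺ (GAdj-mono extend) (f₀ , (q₀ , here refl) , refl))
                      conn⁺⇒conn-or-via
                      (C x y ⊎-dec ((C x u ×-dec C v y) ⊎-dec (C x v ×-dec C u y)))
    where
      u = proj₁ (ends f₀)
      v = proj₂ (ends f₀)
      C = listed-conn? Q Q? L
      extend : ∀ {f} → Listed Q L f → Listed Q (f₀ ∷ L) f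
      extend (qf , f∈L) = qf , there f∈L
      new : ∀ {f} → Listed Q (f₀ ∷ L) f → Listed Q L f ⊎ f ≡ f₀
      new (qf , here refl) = inj₂ refl
      new (qf , there f∈L) = inj₁ (qf , f∈L)
      open ExtraEdge u v (GAdj-extra f₀ new)

  conn? : ∀ Q → Decidable Q → ∀ x y → Dec (Conn (GAdj ends reg Q) x y)
  conn? Q Q? x y = map′ (map (GAdj-mono proj₁)) (map (GAdj-mono (λ {f} qf → qf , ∈-allFin f)))
                        (listed-conn? Q Q? (allFin m) x y)

module Skeleton {n m k : ℕ} (ends : Fin m → Fin n × Fin n) (reg : Fin m → Fin k)
  (Vs : Subset n) (boundary⊆Vs : ∀ v → Boundary ends reg v → v ∈ Vs) where
  open EdgeSets ends reg

  GConn : (Fin m → Set) → Fin n → Fin n → Set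
  GConn P = Conn (GAdj ends reg P)

  RConn : (Fin m → Set) → Fin k → Fin n → Fin n → Set
  RConn P R = Conn (RAdj ends reg P R)

  region⇒graph : ∀ {P R x y} → RConn P R x y → GConn P x y
  region⇒graph = map (GAdj-mono proj₁)

  Hop : (Fin m → Set) → Fin n → Fin n → Set
  Hop P z z' = (z ∈ Vs) × (z' ∈ Vs) ×
    (Σ (Fin k) λ R → InV ends reg R z × InV ends reg R z' × RConn P R z z')

  -- a walk from skeleton vertex z that is now at v and has so far stayed
  -- within one region (or has not moved)
  Within : (Fin m → Set) → Fin n → Fin n → Set
  Within P z v = (z ≡ v) ⊎
    (Σ (Fin k) λ R → InV ends reg R z × InV ends reg R v × RConn P R z v)

  edge-region : ∀ {P v w} → SymClosure (GAdj ends reg P) v w →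
    Σ (Fin m) λ f → Inc ends reg f v × Inc ends reg f w × SymClosure (RAdj ends reg P (reg f)) v w
  edge-region (fwd (f , pf , eq)) = f , inj₁ (cong proj₁ eq) , inj₂ (cong proj₂ eq) , fwd (f , (pf , refl) , eq)
  edge-region (bwd (f , pf , eq)) = f , inj₂ (cong proj₂ eq) , inj₁ (cong proj₁ eq) , bwd (f , (pf , refl) , eq)

  first-edge : ∀ {P v w} (f : Fin m) → Inc ends reg f v → Inc ends reg f w →
    SymClosure (RAdj ends reg P (reg f)) v w → Within P v w
  first-edge f v∈f w∈f s = inj₂ (reg f , (f , refl , v∈f) , (f , refl , w∈f) , s ◅ ε)

  -- A path leaves its current region R only through an edge f ∉ R at a vertex
  -- of R, i.e. at a boundary vertex, which is in V_s: the path ends a hop there.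
  hops : ∀ P {v y} → GConn P v y → y ∈ Vs → ∀ {z} → z ∈ Vs → Within P z v → Star (Hop P) z y
  hops P ε y∈ z∈ (inj₁ refl) = ε
  hops P ε y∈ z∈ (inj₂ (R , z∈R , y∈R , zy)) = (z∈ , y∈ , R , z∈R , y∈R , zy) ◅ ε
  hops P (s ◅ p) y∈ z∈ within with edge-region s
  hops P (s ◅ p) y∈ z∈ (inj₁ refl) | f , v∈f , w∈f , s' = hops P p y∈ z∈ (first-edge f v∈f w∈f s')
  hops P {v} (s ◅ p) y∈ z∈ (inj₂ (R , z∈R , v∈R , zv)) | f , v∈f , w∈f , s' with reg f ≟ R
  ... | yes refl = hops P p y∈ z∈ (inj₂ (reg f , z∈R , (f , refl , w∈f) , zv ◅◅ (s' ◅ ε)))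
  ... | no f∉R = (z∈ , v∈ , R , z∈R , v∈R , zv) ◅ hops P p y∈ v∈ (first-edge f v∈f w∈f s')
    where
      v∈ : v ∈ Vs
      v∈ = boundary⊆Vs v (R , v∈R , f , v∈f , f∉R)

  path⇒hops : ∀ {P x y} → x ∈ Vs → y ∈ Vs → GConn P x y → Star (Hop P) x y
  path⇒hops x∈ y∈ p = hops _ p y∈ x∈ (inj₁ refl)

  module OfEdges (P : Fin m → Set) (P? : Decidable P) where
    SV = SkV ends reg Vs P
    SAdj = SkAdj ends reg Vs P
    SConn = Conn SAdj

    skel : (x : Fin n) → x ∈ Vs → SV
    skel x x∈ = inj₁ (x , x∈)

    π : SV → Fin n
    π (inj₁ (x , _)) = x
    π (inj₂ ((_ , x) , _)) = x

    π∈Vs : ∀ a → π a ∈ Vs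
    π∈Vs (inj₁ (_ , x∈)) = x∈
    π∈Vs (inj₂ (_ , x∈ , _)) = x∈

    to-skel : ∀ a → SConn a (skel (π a) (π∈Vs a))
    to-skel (inj₁ _) = ε
    to-skel (inj₂ (_ , _ , x∈R , _)) = fwd (x∈R , ε) ◅ ε

    skeleton⇒graph : ∀ {a b} → SConn a b → GConn P (π a) (π b)
    skeleton⇒graph = gfold (isEquivalence _) π edge
      where
        edge : ∀ {a b} → SAdj a b → GConn P (π a) (π b)
        edge {inj₂ _} {inj₁ _} (_ , xy) = region⇒graph xy

    -- a hop z ~ z' in R passes through the auxiliary vertex of the class of z
    hop⇒skeleton : ∀ {z z'} (z∈ : z ∈ Vs) (z'∈ : z' ∈ Vs) → Hop P z z' → SConn (skel z z∈) (skel z' z'∈)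
    hop⇒skeleton {z} z∈ z'∈ (_ , _ , R , z∈R , z'∈R , zz') with
      least (λ y → (y ∈ Vs) × InV ends reg R y × RConn P R z y)
        (λ y → (y ∈? Vs) ×-dec (decInV y ×-dec conn? _ (λ f → P? f ×-dec (reg f ≟ R)) z y))
        z (z∈ , z∈R , ε)
      where
        decInV : ∀ y → Dec (InV ends reg R y)
        decInV y = any? λ f → (reg f ≟ R) ×-dec ((proj₁ (ends f) ≟ y) ⊎-dec (proj₂ (ends f) ≟ y))
    ... | r , (r∈ , r∈R , zr) , r-least = bwd {b = class} (z∈R , rz) ◅ fwd (z'∈R , rz ◅◅ zz') ◅ ε
      where
        rz : RConn P R r z
        rz = symmetric _ zr
        class : SV
        class = inj₂ ((R , r) , r∈ , r∈R , λ y y∈ y∈R ry → r-least y (y∈ , y∈R , zr ◅◅ ry))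

    graph⇒skeleton : ∀ {x y} (x∈ : x ∈ Vs) (y∈ : y ∈ Vs) → GConn P x y → SConn (skel x x∈) (skel y y∈)
    graph⇒skeleton x∈ y∈ p = chain x∈ y∈ (path⇒hops x∈ y∈ p)
      where
        chain : ∀ {x y} (x∈ : x ∈ Vs) (y∈ : y ∈ Vs) → Star (Hop P) x y → SConn (skel x x∈) (skel y y∈)
        chain x∈ y∈ ε rewrite []=-irrelevant x∈ y∈ = ε
        chain x∈ y∈ (h ◅ hs) = hop⇒skeleton x∈ (proj₁ (proj₂ h)) h ◅◅ chain _ y∈ hs

module Deletion {n m k : ℕ} (ends : Fin m → Fin n × Fin n) (reg : Fin m → Fin k)
  (Vs : Subset n) (boundary⊆Vs : ∀ v → Boundary ends reg v → v ∈ Vs) (A : Subset m) (e : Fin m) where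
  open EdgeSets ends reg
  open Skeleton ends reg Vs boundary⊆Vs

  u = proj₁ (ends e)
  v = proj₂ (ends e)

  Del? : Decidable (Del A e)
  Del? f = (f ∈? A) ×-dec ¬? (f ≟ e)

  lost-in-graph : ∀ {f} → f ∈ A → Del A e f ⊎ f ≡ e
  lost-in-graph {f} f∈A with f ≟ e
  ... | yes f≡e = inj₂ f≡e
  ... | no f≢e = inj₁ (f∈A , f≢e)

  lost-in-region : ∀ {R f} → (f ∈ A) × (reg f ≡ R) → (Del A e f × (reg f ≡ R)) ⊎ f ≡ e
  lost-in-region (f∈A , f∈R) = Sum.map₁ (_, f∈R) (lost-in-graph f∈A)

  module InGraph = ExtraEdge u v (GAdj-extra e lost-in-graph)
  module InRegion (R : Fin k) = ExtraEdge u v (GAdj-extra e (lost-in-region {R}))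

  remaining⇒present : ∀ {x y} → GConn (Del A e) x y → GConn (_∈ A) x y
  remaining⇒present = map (GAdj-mono proj₁)

  GraphSplit : Set
  GraphSplit = Σ (Fin n) λ a → Σ (Fin n) λ b → Separated (GAdj ends reg (_∈ A)) (GAdj ends reg (Del A e)) a b

  VsSplit : Set
  VsSplit = Σ (Fin n) λ x → Σ (Fin n) λ y →
    (x ∈ Vs) × (y ∈ Vs) × Separated (GAdj ends reg (_∈ A)) (GAdj ends reg (Del A e)) x y

  RegionSplit : Set
  RegionSplit = Σ (Fin k) λ R → Σ (Fin n) λ x → Σ (Fin n) λ y →
    (x ∈ Vs) × (y ∈ Vs) × InV ends reg R x × InV ends reg R y ×
    RConn (_∈ A) R x y × ¬ RConn (Del A e) R x y

  vsSplit⇒graphSplit : VsSplit → GraphSplit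
  vsSplit⇒graphSplit (x , y , _ , _ , s) = x , y , s

  -- along the hops from x to y some hop must break, as x and y end up apart
  vsSplit⇒regionSplit : VsSplit → RegionSplit
  vsSplit⇒regionSplit (x , y , x∈ , y∈ , xy , ¬xy) = broken (path⇒hops x∈ y∈ xy) ¬xy
    where
      broken : ∀ {z} → Star (Hop (_∈ A)) z y → ¬ GConn (Del A e) z y → RegionSplit
      broken ε ¬zy = ⊥-elim (¬zy ε)
      broken {z} ((z∈ , z'∈ , R , z∈R , z'∈R , zz') ◅ hs) ¬zy
        with conn? _ (λ f → Del? f ×-dec (reg f ≟ R)) z _
      ... | no ¬zz' = R , z , _ , z∈ , z'∈ , z∈R , z'∈R , zz' , ¬zz'
      ... | yes zz'⁻ = broken hs (λ z'y → ¬zy (region⇒graph zz'⁻ ◅◅ z'y))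

  -- if e is a bridge, a pair that a region loses through e is lost in G too:
  -- it is joined in R - e to u and v, which G - e does not join
  bridge⇒vsSplit : GraphSplit → RegionSplit → VsSplit
  bridge⇒vsSplit (_ , _ , bridge) (R , x , y , x∈ , y∈ , _ , _ , xy , ¬xy) =
    x , y , x∈ , y∈ , region⇒graph xy , separate (InRegion.separated⇒via R (xy , ¬xy))
    where
      ¬uv : ¬ GConn (Del A e) u v
      ¬uv = InGraph.separated⇒ends-separated bridge
      separate : InRegion.ViaEdge R x y → ¬ GConn (Del A e) x y
      separate (inj₁ (xu , vy)) xy⁻ =
        ¬uv (symmetric _ (region⇒graph xu) ◅◅ xy⁻ ◅◅ symmetric _ (region⇒graph vy))
      separate (inj₂ (xv , uy)) xy⁻ =
        ¬uv (region⇒graph uy ◅◅ symmetric _ xy⁻ ◅◅ region⇒graph xv)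

  module Before = OfEdges (_∈ A) (_∈? A)
  module After = OfEdges (Del A e) Del?

  ψ : Before.SV → After.SV
  ψ a = After.skel (Before.π a) (Before.π∈Vs a)

  ψ-covers : ∀ b → Σ Before.SV λ a → After.SConn (ψ a) b
  ψ-covers (inj₁ x) = inj₁ x , ε
  ψ-covers (inj₂ ((_ , x) , x∈ , x∈R , _)) = inj₁ (x , x∈) , bwd (x∈R , ε) ◅ ε

  ψ-reflects : ∀ {a b} → After.SConn (ψ a) (ψ b) → Before.SConn a b
  ψ-reflects {a} {b} ab = Before.to-skel a
    ◅◅ Before.graph⇒skeleton _ _ (remaining⇒present (After.skeleton⇒graph ab))
    ◅◅ symmetric _ (Before.to-skel b)

  SkeletonSplit : Set
  SkeletonSplit = Σ Before.SV λ a → Σ Before.SV λ b → Before.SConn a b × ¬ After.SConn (ψ a) (ψ b)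

  skeletonSplit⇒vsSplit : SkeletonSplit → VsSplit
  skeletonSplit⇒vsSplit (a , b , ab , ¬ab) =
    Before.π a , Before.π b , Before.π∈Vs a , Before.π∈Vs b , Before.skeleton⇒graph ab ,
    λ ab⁻ → ¬ab (After.graph⇒skeleton _ _ ab⁻)

  vsSplit⇒skeletonSplit : VsSplit → SkeletonSplit
  vsSplit⇒skeletonSplit (x , y , x∈ , y∈ , xy , ¬xy) =
    Before.skel x x∈ , Before.skel y y∈ , Before.graph⇒skeleton x∈ y∈ xy ,
    λ xy⁻ → ¬xy (After.skeleton⇒graph xy⁻)

lemma4 : ∀ {n m k : ℕ} (ends : Fin m → Fin n × Fin n) (reg : Fin m → Fin k)
    (Vs : Subset n) → (∀ v → Boundary ends reg v → v ∈ Vs) →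
    (A : Subset m) (e : Fin m) → e ∈ A →
    (cG cG' cS cS' : ℕ) →
    HasComponents (GAdj ends reg (_∈ A)) cG →
    HasComponents (GAdj ends reg (Del A e)) cG' →
    HasComponents (SkAdj ends reg Vs (_∈ A)) cS →
    HasComponents (SkAdj ends reg Vs (Del A e)) cS' →
    (cS < cS' ⇔
      ((cG < cG') ×
       Σ (Fin k) λ R → Σ (Fin n) λ x → Σ (Fin n) λ y →
         (x ∈ Vs) × (y ∈ Vs) × InV ends reg R x × InV ends reg R y ×
         Conn (RAdj ends reg (_∈ A) R) x y × ¬ Conn (RAdj ends reg (Del A e) R) x y))
lemma4 ends reg Vs boundary⊆Vs A e _ cG cG' cS cS' HG HG' HS HS' = mk⇔ split⇒critical critical⇒split
  where
    open Deletion ends reg Vs boundary⊆Vs A e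
    graphCount : cG < cG' ⇔ GraphSplit
    graphCount = ComponentCount.more⇔separated HG HG' id (λ b → b , ε) remaining⇒present
    skeletonCount : cS < cS' ⇔ SkeletonSplit
    skeletonCount = ComponentCount.more⇔separated HS HS' ψ ψ-covers ψ-reflects

    split⇒critical : cS < cS' → (cG < cG') × RegionSplit
    split⇒critical lt = Equivalence.from graphCount (vsSplit⇒graphSplit s) , vsSplit⇒regionSplit s
      where s = skeletonSplit⇒vsSplit (Equivalence.to skeletonCount lt)

    critical⇒split : (cG < cG') × RegionSplit → cS < cS'
    critical⇒split (lt , r) =
      Equivalence.from skeletonCount (vsSplit⇒skeletonSplit (bridge⇒vsSplit (Equivalence.to graphCount lt) r))
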